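{- Let $n\ge 3$ and let $(u,x,z)$ be a $2$-path in $CT_n$. If $|\mathrm{supp}(\{x,u\})\cap\mathrm{supp}(\{x,z\})|=0$, then there is a unique $4$-cycle in $CT_n$ containing $(u,x,z)$, namely $(x,z,zx^{ -1}u,u,x)$; and if $|\mathrm{supp}(\{x,u\})\cap\mathrm{supp}(\{x,z\})|=1$, then there are exactly two $4$-cycles in $CT_n$ containing $(u,x,z)$, namely $(x,z,zx^{ -1}u,u,x)$ and $(x,z,ux^{ -1}z,u,x)$.
   Context: $\mathrm{S}_n$ is the symmetric group on $\{1,\dots,n\}$. $CT_n$ is the graph with vertex set $\mathrm{S}_n$ in which $x,y$ are adjacent iff $y=ux$ for some transposition $u$. The support of $x\in\mathrm{S}_n$ is $\mathrm{supp}(x)=\{i: i^x\ne i\}$. The support of an edge $\{u,z\}$ of $CT_n$ is $\mathrm{supp}(\{u,z\})=\mathrm{supp}(zu^{ -1})$, a $2$-subset of $\{1,\dots,n\}$. -}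

module Defs where

open import Data.Nat using (ℕ)
open import Data.Fin using (Fin; _≟_)
open import Data.Fin.Permutation using (Permutation′; _⟨$⟩ʳ_; _∘ₚ_; flip; transpose; _≈_) public
open import Data.Fin.Subset using (Subset)
open import Data.Vec using (tabulate)
open import Data.Bool using (not)
open import Data.Product using (Σ; _×_)
open import Relation.Nullary using (¬_)
open import Relation.Nullary.Decidable using (⌊_⌋)
open import Relation.Binary.PropositionalEquality using (_≡_)

-- Convention (as in the paper):
-- permutations act on the right, i^(xy) = (i^x)^y, which is exactly
-- x ∘ₚ y in the standard library (apply x first, then y).
-- Equality of permutations is pointwise equality _≈_.

_·_ : ∀ {n} → Permutation′ n → Permutation′ n → Permutation′ n
x · y = x ∘ₚ y

_⁻¹ : ∀ {n} → Permutation′ n → Permutation′ n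
x ⁻¹ = flip x

IsTransposition : ∀ {n} → Permutation′ n → Set
IsTransposition {n} t = Σ (Fin n) λ i → Σ (Fin n) λ j → ¬ (i ≡ j) × (t ≈ transpose i j)

Adj : ∀ {n} → Permutation′ n → Permutation′ n → Set
Adj {n} x y = Σ (Permutation′ n) λ t → IsTransposition t × (y ≈ (t · x))

supp : ∀ {n} → Permutation′ n → Subset n
supp x = tabulate λ i → not ⌊ x ⟨$⟩ʳ i ≟ i ⌋

-- support of the edge {u,z}: supp(z u⁻¹)
edgeSupp : ∀ {n} → Permutation′ n → Permutation′ n → Subset n
edgeSupp u z = supp (z · (u ⁻¹))

Is2Path : ∀ {n} → Permutation′ n → Permutation′ n → Permutation′ n → Set
Is2Path u x z = Adj u x × Adj x z × ¬ (u ≈ z)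

-- Every 4-cycle containing the 2-path (u,x,z) (i.e. the edges ux, xz) is
-- uniquely of this form, determined by its fourth vertex w.
Is4Cycle : ∀ {n} → Permutation′ n → Permutation′ n → Permutation′ n → Permutation′ n → Set
Is4Cycle x z w u =
  Adj x z × Adj z w × Adj w u × Adj u x ×
  ¬ (x ≈ z) × ¬ (x ≈ w) × ¬ (x ≈ u) × ¬ (z ≈ w) × ¬ (z ≈ u) × ¬ (w ≈ u)

-- Seen from x, i.e. after right multiplication by x ⁻¹, the neighbours of x are the
-- transpositions: z and u become S = (i j) and R = (k l), and S ≠ R since u ≠ z.  A fourth
-- vertex w = A · z with u = B · w (A, B transpositions) amounts, as maps, to A ∘ B = S ∘ R,
-- with A ≠ S since w ≠ x.  If B moved both k and l it would be R, forcing A = S; so B fixes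
-- k or l, and evaluating at that point pins A down to R (w = u x⁻¹ z) or to S R S
-- (w = z x⁻¹ u).  Both vertices do close 4-cycles, and they coincide exactly when R and S
-- commute: when their supports are disjoint, not when they share a point.
module Submission where

open import Defs
open import Data.Bool using (true; false; not)
open import Data.Fin using (Fin)
open import Data.Fin.Properties using (_≟_)
open import Data.Fin.Permutation using (_⟨$⟩ˡ_; inverseˡ; inverseʳ)
open import Data.Fin.Permutation.Components using (transpose-inverse) renaming (transpose to τ)
open import Data.Fin.Subset using (Subset; _∈_; _∩_; _-_; ∣_∣; Nonempty; Empty)
open import Data.Fin.Subset.Properties
  using (x∈p∩q⁺; x∈p∩q⁻; x∈p⇒∣p-x∣<∣p∣; nonempty?; Empty-unique; ∣⊥∣≡0)
open import Data.Nat using (ℕ; _≥_; _<_)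
open import Data.Nat.Properties using (n≮0; 1+n≢0)
open import Data.Product using (_×_; Σ-syntax; _,_; proj₁; proj₂)
open import Data.Sum using (_⊎_; inj₁; inj₂; [_,_]′)
open import Data.Vec using (lookup)
open import Data.Vec.Properties using (lookup⇒[]=; []=⇒lookup; lookup∘tabulate)
open import Function using (_∘_; id)
open import Relation.Nullary using (¬_; Dec; does; yes; no; contradiction)
open import Relation.Nullary.Decidable using (dec-true; dec-false; decidable-stable; isYes≗does)
open import Relation.Binary.PropositionalEquality
  using (_≡_; _≢_; _≗_; refl; sym; trans; cong; cong₂; subst; module ≡-Reasoning)

open ≡-Reasoning

module _ {n : ℕ} where

  τ-matchˡ : (i j : Fin n) → τ i j i ≡ j
  τ-matchˡ i j rewrite dec-true (i ≟ i) refl = refl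

  τ-matchʳ : (i j : Fin n) → τ i j j ≡ i
  τ-matchʳ i j with j ≟ i
  ... | yes refl = refl
  ... | no _ rewrite dec-true (j ≟ j) refl = refl

  τ-mismatch : {i j y : Fin n} → y ≢ i → y ≢ j → τ i j y ≡ y
  τ-mismatch {i} {j} {y} y≢i y≢j rewrite dec-false (y ≟ i) y≢i | dec-false (y ≟ j) y≢j = refl

  τ-moved : {i j y : Fin n} → τ i j y ≢ y → y ≡ i ⊎ y ≡ j
  τ-moved {i} {j} {y} moved = go (y ≟ i) (y ≟ j)
    where
    go : Dec (y ≡ i) → Dec (y ≡ j) → y ≡ i ⊎ y ≡ j
    go (yes y≡i) _         = inj₁ y≡i
    go (no _)    (yes y≡j) = inj₂ y≡j
    go (no y≢i)  (no y≢j)  = contradiction (τ-mismatch y≢i y≢j) moved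

  τ-comm : (i j : Fin n) → τ i j ≗ τ j i
  τ-comm i j y = go y (y ≟ i) (y ≟ j)
    where
    go : ∀ y → Dec (y ≡ i) → Dec (y ≡ j) → τ i j y ≡ τ j i y
    go y (yes refl) _          = trans (τ-matchˡ y j) (sym (τ-matchʳ j y))
    go y (no _)     (yes refl) = trans (τ-matchʳ i y) (sym (τ-matchˡ y i))
    go y (no y≢i)   (no y≢j)   = trans (τ-mismatch y≢i y≢j) (sym (τ-mismatch y≢j y≢i))

  τ-involutive : (i j : Fin n) → τ i j ∘ τ i j ≗ id
  τ-involutive i j y = trans (cong (τ i j) (τ-comm i j y)) (transpose-inverse i j)

  τ-≡-flip : (i j : Fin n) {a b : Fin n} → τ i j a ≡ b → a ≡ τ i j b
  τ-≡-flip i j {a} e = trans (sym (τ-involutive i j a)) (cong (τ i j) e)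

  τ-injective : (i j : Fin n) {a b : Fin n} → τ i j a ≡ τ i j b → a ≡ b
  τ-injective i j {b = b} e = trans (τ-≡-flip i j e) (τ-involutive i j b)

  τ-≉-id : {i j : Fin n} → i ≢ j → ¬ τ i j ≗ id
  τ-≉-id {i} {j} i≢j e = i≢j (sym (trans (sym (τ-matchˡ i j)) (e i)))

  τ-unique : {i j k l : Fin n} → k ≢ l → τ i j k ≢ k → τ i j l ≢ l → τ i j ≗ τ k l
  τ-unique {i} {j} k≢l k-moved l-moved = go k≢l (τ-moved k-moved) (τ-moved l-moved)
    where
    go : ∀ {k l} → k ≢ l → k ≡ i ⊎ k ≡ j → l ≡ i ⊎ l ≡ j → τ i j ≗ τ k l
    go k≢l (inj₁ refl) (inj₁ refl) = contradiction refl k≢l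
    go _   (inj₁ refl) (inj₂ refl) = λ _ → refl
    go _   (inj₂ refl) (inj₁ refl) = τ-comm i j
    go k≢l (inj₂ refl) (inj₂ refl) = contradiction refl k≢l

  τ-determined : {p q k l : Fin n} → τ p q k ≡ l → k ≢ l → τ p q ≗ τ k l
  τ-determined {p} {q} {k} {l} e k≢l =
    τ-unique k≢l (λ e′ → k≢l (trans (sym e′) e)) (λ e′ → k≢l (sym (trans (sym e′) l↦k)))
    where
    l↦k : τ p q l ≡ k
    l↦k = sym (τ-≡-flip p q e)

  τ-conjugate : (i j k l : Fin n) → τ (τ i j k) (τ i j l) ≗ τ i j ∘ τ k l ∘ τ i j
  τ-conjugate i j k l y = go y (y ≟ S k) (y ≟ S l)
    where
    S : Fin n → Fin n
    S = τ i j
    go : ∀ y → Dec (y ≡ S k) → Dec (y ≡ S l) → τ (S k) (S l) y ≡ S (τ k l (S y))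
    go _ (yes refl) _ = begin
      τ (S k) (S l) (S k)      ≡⟨ τ-matchˡ (S k) (S l) ⟩
      S l                      ≡⟨ cong S (τ-matchˡ k l) ⟨
      S (τ k l k)              ≡⟨ cong (S ∘ τ k l) (τ-involutive i j k) ⟨
      S (τ k l (S (S k)))      ∎
    go _ (no _) (yes refl) = begin
      τ (S k) (S l) (S l)      ≡⟨ τ-matchʳ (S k) (S l) ⟩
      S k                      ≡⟨ cong S (τ-matchʳ k l) ⟨
      S (τ k l l)              ≡⟨ cong (S ∘ τ k l) (τ-involutive i j l) ⟨
      S (τ k l (S (S l)))      ∎
    go y (no y≢Sk) (no y≢Sl) = begin
      τ (S k) (S l) y          ≡⟨ τ-mismatch y≢Sk y≢Sl ⟩
      y                        ≡⟨ τ-involutive i j y ⟨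
      S (S y)                  ≡⟨ cong S (τ-mismatch (y≢Sk ∘ τ-≡-flip i j) (y≢Sl ∘ τ-≡-flip i j)) ⟨
      S (τ k l (S y))          ∎

  τ-commute : {i j k l : Fin n} → τ i j k ≡ k → τ i j l ≡ l → τ i j ∘ τ k l ≗ τ k l ∘ τ i j
  τ-commute {i} {j} {k} {l} Sk≡k Sl≡l y = begin
    S (τ k l y)              ≡⟨ cong (S ∘ τ k l) (τ-involutive i j y) ⟨
    S (τ k l (S (S y)))      ≡⟨ τ-conjugate i j k l (S y) ⟨
    τ (S k) (S l) (S y)      ≡⟨ cong₂ (λ a b → τ a b (S y)) Sk≡k Sl≡l ⟩
    τ k l (S y)              ∎
    where
    S : Fin n → Fin n
    S = τ i j

  τ-noncommute : {i j k l c : Fin n} → ¬ τ i j ≗ τ k l → τ i j c ≢ c → τ k l c ≢ c →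
                 τ k l (τ i j c) ≢ τ i j (τ k l c)
  τ-noncommute {i} {j} {k} {l} {c} S≉R Sc≢c Rc≢c with τ i j c ≟ τ k l c
  ... | yes Sc≡Rc = contradiction S≗R S≉R
    where
    S≗R : τ i j ≗ τ k l
    S≗R y = begin
      τ i j y                ≡⟨ τ-determined refl (Sc≢c ∘ sym) y ⟩
      τ c (τ i j c) y        ≡⟨ cong (λ v → τ c v y) Sc≡Rc ⟩
      τ c (τ k l c) y        ≡⟨ τ-determined refl (Rc≢c ∘ sym) y ⟨
      τ k l y                ∎
  ... | no Sc≢Rc = λ RSc≡SRc → Sc≢Rc (begin
      τ i j c                ≡⟨ RSc≡Sc ⟨
      τ k l (τ i j c)        ≡⟨ RSc≡SRc ⟩
      τ i j (τ k l c)        ≡⟨ SRc≡Rc ⟩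
      τ k l c                ∎)
    where
    RSc≡Sc : τ k l (τ i j c) ≡ τ i j c
    RSc≡Sc = trans (τ-determined refl (Rc≢c ∘ sym) (τ i j c)) (τ-mismatch Sc≢c Sc≢Rc)
    SRc≡Rc : τ i j (τ k l c) ≡ τ k l c
    SRc≡Rc = trans (τ-determined refl (Sc≢c ∘ sym) (τ k l c)) (τ-mismatch Rc≢c (Sc≢Rc ∘ sym))

  τ-square-fixed : {i j k l p q : Fin n} {R : Fin n → Fin n} → R ≗ τ k l → k ≢ l → ¬ τ i j ≗ R →
                   τ p q k ≡ τ i j l → τ p q ≗ R ⊎ τ p q ≗ τ i j ∘ R ∘ τ i j
  τ-square-fixed {i} {j} {k} {l} {p} {q} {R} R≗ k≢l S≉R Ak≡Sl with τ i j l ≟ l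
  ... | yes Sl≡l = inj₁ λ y → trans (τ-determined (trans Ak≡Sl Sl≡l) k≢l y) (sym (R≗ y))
  ... | no Sl≢l with τ i j k ≟ k
  ...   | no Sk≢k = contradiction (λ y → trans (τ-unique k≢l Sk≢k Sl≢l y) (sym (R≗ y))) S≉R
  ...   | yes Sk≡k = inj₂ λ y → begin
    τ p q y                      ≡⟨ τ-determined (trans (cong (τ p q) Sk≡k) Ak≡Sl) (k≢l ∘ τ-injective i j) y ⟩
    τ (τ i j k) (τ i j l) y      ≡⟨ τ-conjugate i j k l y ⟩
    τ i j (τ k l (τ i j y))      ≡⟨ cong (τ i j) (R≗ (τ i j y)) ⟨
    τ i j (R (τ i j y))          ∎

  τ-square : {i j k l p q r m : Fin n} → k ≢ l → ¬ τ i j ≗ τ k l → ¬ τ p q ≗ τ i j →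
             τ p q ∘ τ r m ≗ τ i j ∘ τ k l →
             τ p q ≗ τ k l ⊎ τ p q ≗ τ i j ∘ τ k l ∘ τ i j
  τ-square {i} {j} {k} {l} {p} {q} {r} {m} k≢l S≉R A≉S AB≗SR with τ r m k ≟ k | τ r m l ≟ l
  ... | yes Bk≡k | _ = τ-square-fixed (λ _ → refl) k≢l S≉R
    (trans (cong (τ p q) (sym Bk≡k)) (trans (AB≗SR k) (cong (τ i j) (τ-matchˡ k l))))
  ... | no _ | yes Bl≡l = τ-square-fixed (τ-comm k l) (k≢l ∘ sym) S≉R
    (trans (cong (τ p q) (sym Bl≡l)) (trans (AB≗SR l) (cong (τ i j) (τ-matchʳ k l))))
  ... | no Bk≢k | no Bl≢l = contradiction A≗S A≉S
    where
    A≗S : τ p q ≗ τ i j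
    A≗S y = begin
      τ p q y                    ≡⟨ cong (τ p q) (τ-involutive k l y) ⟨
      τ p q (τ k l (τ k l y))    ≡⟨ cong (τ p q) (τ-unique k≢l Bk≢k Bl≢l (τ k l y)) ⟨
      τ p q (τ r m (τ k l y))    ≡⟨ AB≗SR (τ k l y) ⟩
      τ i j (τ k l (τ k l y))    ≡⟨ cong (τ i j) (τ-involutive k l y) ⟩
      τ i j y                    ∎

∣p∣≡0⇒Empty : ∀ {n} {p : Subset n} → ∣ p ∣ ≡ 0 → Empty p
∣p∣≡0⇒Empty {p = p} ∣p∣≡0 (y , y∈p) = n≮0 (subst (∣ p - y ∣ <_) ∣p∣≡0 (x∈p⇒∣p-x∣<∣p∣ y∈p))

∣p∣≢0⇒Nonempty : ∀ {n} {p : Subset n} → ∣ p ∣ ≢ 0 → Nonempty p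
∣p∣≢0⇒Nonempty {n} {p} ∣p∣≢0 =
  decidable-stable (nonempty? p) λ empty → ∣p∣≢0 (trans (cong ∣_∣ (Empty-unique empty)) (∣⊥∣≡0 n))

module _ {n : ℕ} {π : Permutation′ n} {y : Fin n} where

  lookup-supp : lookup (supp π) y ≡ not (does (π ⟨$⟩ʳ y ≟ y))
  lookup-supp = trans (lookup∘tabulate _ y) (cong not (isYes≗does _))

  ∈-supp⁺ : π ⟨$⟩ʳ y ≢ y → y ∈ supp π
  ∈-supp⁺ moved = lookup⇒[]= y (supp π) (trans lookup-supp (cong not (dec-false (π ⟨$⟩ʳ y ≟ y) moved)))

  ∈-supp⁻ : y ∈ supp π → π ⟨$⟩ʳ y ≢ y
  ∈-supp⁻ y∈supp fixed = contradiction true≡false λ ()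
    where
    true≡false : true ≡ false
    true≡false = trans (sym ([]=⇒lookup y∈supp)) (trans lookup-supp (cong not (dec-true (π ⟨$⟩ʳ y ≟ y) fixed)))

-- w / x is the map of w · x ⁻¹, so that w ≈ t · x exactly when w / x ≗ t ⟨$⟩ʳ_.
_/_ : ∀ {n} → Permutation′ n → Permutation′ n → Fin n → Fin n
(w / x) y = x ⟨$⟩ˡ (w ⟨$⟩ʳ y)

module _ {n : ℕ} (x : Permutation′ n) where

  /-self : x / x ≗ id
  /-self _ = inverseˡ x

  /-cong : {v w : Permutation′ n} → v ≈ w → v / x ≗ w / x
  /-cong v≈w y = cong (x ⟨$⟩ˡ_) (v≈w y)

  /-injective : {v w : Permutation′ n} → v / x ≗ w / x → v ≈ w
  /-injective {v} {w} e y = begin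
    v ⟨$⟩ʳ y                     ≡⟨ inverseʳ x ⟨
    x ⟨$⟩ʳ (v / x) y             ≡⟨ cong (x ⟨$⟩ʳ_) (e y) ⟩
    x ⟨$⟩ʳ (w / x) y             ≡⟨ inverseʳ x ⟩
    w ⟨$⟩ʳ y                     ∎

  ≉-from-/ : {v w : Permutation′ n} {f g : Fin n → Fin n} →
             v / x ≗ f → w / x ≗ g → ¬ f ≗ g → ¬ v ≈ w
  ≉-from-/ {v} {w} v/x≗f w/x≗g f≉g v≈w = f≉g λ y →
    trans (sym (v/x≗f y)) (trans (/-cong {v} {w} v≈w y) (w/x≗g y))

  Adj⇒/ : {v w : Permutation′ n} → Adj v w → Σ[ p ∈ Fin n ] Σ[ q ∈ Fin n ] p ≢ q × w / x ≗ (v / x) ∘ τ p q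
  Adj⇒/ {v} {w} (t , (p , q , p≢q , t≈τ) , w≈tv) =
    p , q , p≢q , λ y → trans (/-cong {w} {t · v} w≈tv y) (cong (v / x) (t≈τ y))

  /⇒Adj : {v w : Permutation′ n} {p q : Fin n} → p ≢ q → w / x ≗ (v / x) ∘ τ p q → Adj v w
  /⇒Adj {v} {w} {p} {q} p≢q e =
    transpose p q , (p , q , p≢q , λ _ → refl) , /-injective {w} {transpose p q · v} e

Adj⇒/τ : ∀ {n} {x w : Permutation′ n} → Adj x w → Σ[ p ∈ Fin n ] Σ[ q ∈ Fin n ] p ≢ q × w / x ≗ τ p q
Adj⇒/τ {x = x} {w} adj with Adj⇒/ x {x} {w} adj
... | p , q , p≢q , w/x≗ = p , q , p≢q , λ y → trans (w/x≗ y) (/-self x (τ p q y))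

Adj-sym : ∀ {n} {v w : Permutation′ n} → Adj v w → Adj w v
Adj-sym {v = v} {w} adj with Adj⇒/τ {x = v} {w} adj
... | p , q , p≢q , w/v≗τ = /⇒Adj v {w} {v} p≢q λ y → begin
  (v / v) y                    ≡⟨ /-self v y ⟩
  y                            ≡⟨ τ-involutive p q y ⟨
  τ p q (τ p q y)              ≡⟨ w/v≗τ (τ p q y) ⟨
  (w / v) (τ p q y)            ∎

Is4Cycle-reverse : ∀ {n} {x z w u : Permutation′ n} → Is4Cycle x z w u → Is4Cycle x u w z
Is4Cycle-reverse {x = x} {z} {w} {u} (xz , zw , wu , ux , x≉z , x≉w , x≉u , z≉w , z≉u , w≉u) =
  Adj-sym {v = u} {x} ux , Adj-sym {v = w} {u} wu , Adj-sym {v = z} {w} zw , Adj-sym {v = x} {z} xz ,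
  x≉u , x≉w , x≉z , (λ u≈w → w≉u (sym ∘ u≈w)) , (λ u≈z → z≉u (sym ∘ u≈z)) , (λ w≈z → z≉w (sym ∘ w≈z))

module FourCycles {n : ℕ} {x z u : Permutation′ n} {i j k l : Fin n}
  (i≢j : i ≢ j) (k≢l : k ≢ l) (z/x≗S : z / x ≗ τ i j) (u/x≗R : u / x ≗ τ k l) (S≉R : ¬ τ i j ≗ τ k l)
  where

  private
    S R : Fin n → Fin n
    S = τ i j
    R = τ k l

  zx⁻¹u/x≗RS : ((z · (x ⁻¹)) · u) / x ≗ R ∘ S
  zx⁻¹u/x≗RS y = trans (u/x≗R _) (cong R (z/x≗S y))

  ux⁻¹z/x≗SR : ((u · (x ⁻¹)) · z) / x ≗ S ∘ R
  ux⁻¹z/x≗SR y = trans (z/x≗S _) (cong S (u/x≗R y))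

  zx⁻¹u-4cycle : Is4Cycle x z ((z · (x ⁻¹)) · u) u
  zx⁻¹u-4cycle = x~z , z~W , W~u , u~x , x≉z , x≉W , x≉u , z≉W , z≉u , W≉u
    where
    W : Permutation′ n
    W = (z · (x ⁻¹)) · u
    x~z : Adj x z
    x~z = /⇒Adj x {x} {z} i≢j λ y → trans (z/x≗S y) (sym (/-self x (S y)))
    z~W : Adj z W
    z~W = /⇒Adj x {z} {W} (k≢l ∘ τ-injective i j) λ y → begin
      (W / x) y                  ≡⟨ zx⁻¹u/x≗RS y ⟩
      R (S y)                    ≡⟨ τ-involutive i j _ ⟨
      S (S (R (S y)))            ≡⟨ cong S (τ-conjugate i j k l y) ⟨
      S (τ (S k) (S l) y)        ≡⟨ z/x≗S _ ⟨
      (z / x) (τ (S k) (S l) y)  ∎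
    W~u : Adj W u
    W~u = /⇒Adj x {W} {u} i≢j λ y → begin
      (u / x) y                  ≡⟨ u/x≗R y ⟩
      R y                        ≡⟨ cong R (τ-involutive i j y) ⟨
      R (S (S y))                ≡⟨ zx⁻¹u/x≗RS (S y) ⟨
      (W / x) (S y)              ∎
    u~x : Adj u x
    u~x = /⇒Adj x {u} {x} k≢l λ y → begin
      (x / x) y                  ≡⟨ /-self x y ⟩
      y                          ≡⟨ τ-involutive k l y ⟨
      R (R y)                    ≡⟨ u/x≗R (R y) ⟨
      (u / x) (R y)              ∎
    x≉z : ¬ x ≈ z
    x≉z = ≉-from-/ x {x} {z} (/-self x) z/x≗S λ id≗S → τ-≉-id i≢j (sym ∘ id≗S)
    x≉W : ¬ x ≈ W
    x≉W = ≉-from-/ x {x} {W} (/-self x) zx⁻¹u/x≗RS λ id≗RS →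
      S≉R λ y → trans (sym (τ-involutive k l (S y))) (cong R (sym (id≗RS y)))
    x≉u : ¬ x ≈ u
    x≉u = ≉-from-/ x {x} {u} (/-self x) u/x≗R λ id≗R → τ-≉-id k≢l (sym ∘ id≗R)
    z≉W : ¬ z ≈ W
    z≉W = ≉-from-/ x {z} {W} z/x≗S zx⁻¹u/x≗RS λ S≗RS →
      τ-≉-id k≢l λ y → trans (cong R (sym (τ-involutive i j y))) (trans (sym (S≗RS (S y))) (τ-involutive i j y))
    z≉u : ¬ z ≈ u
    z≉u = ≉-from-/ x {z} {u} z/x≗S u/x≗R S≉R
    W≉u : ¬ W ≈ u
    W≉u = ≉-from-/ x {W} {u} zx⁻¹u/x≗RS u/x≗R λ RS≗R →
      τ-≉-id i≢j λ y → trans (sym (τ-involutive k l (S y))) (trans (cong R (RS≗R y)) (τ-involutive k l y))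

  fourth-vertex : {w : Permutation′ n} → Is4Cycle x z w u →
                  w ≈ ((z · (x ⁻¹)) · u) ⊎ w ≈ ((u · (x ⁻¹)) · z)
  fourth-vertex {w} (_ , zw , wu , _ , _ , x≉w , _)
    with Adj⇒/ x {z} {w} zw | Adj⇒/ x {w} {u} wu
  ... | p , q , _ , w/x≗zA | r , m , _ , u/x≗wB =
    [ inj₂ ∘ w≈ux⁻¹z , inj₁ ∘ w≈zx⁻¹u ]′ (τ-square k≢l S≉R A≉S AB≗SR)
    where
    A B : Fin n → Fin n
    A = τ p q
    B = τ r m
    w/x≗SA : w / x ≗ S ∘ A
    w/x≗SA y = trans (w/x≗zA y) (z/x≗S (A y))
    A≉S : ¬ A ≗ S
    A≉S A≗S = x≉w (/-injective x {x} {w} λ y → begin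
      (x / x) y                  ≡⟨ /-self x y ⟩
      y                          ≡⟨ τ-involutive i j y ⟨
      S (S y)                    ≡⟨ cong S (A≗S y) ⟨
      S (A y)                    ≡⟨ w/x≗SA y ⟨
      (w / x) y                  ∎)
    AB≗SR : A ∘ B ≗ S ∘ R
    AB≗SR y = begin
      A (B y)                    ≡⟨ τ-involutive i j _ ⟨
      S (S (A (B y)))            ≡⟨ cong S (w/x≗SA (B y)) ⟨
      S ((w / x) (B y))          ≡⟨ cong S (u/x≗wB y) ⟨
      S ((u / x) y)              ≡⟨ cong S (u/x≗R y) ⟩
      S (R y)                    ∎
    w≈ux⁻¹z : A ≗ R → w ≈ ((u · (x ⁻¹)) · z)
    w≈ux⁻¹z A≗R = /-injective x {w} {(u · (x ⁻¹)) · z} λ y →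
      trans (w/x≗SA y) (trans (cong S (A≗R y)) (sym (ux⁻¹z/x≗SR y)))
    w≈zx⁻¹u : A ≗ S ∘ R ∘ S → w ≈ ((z · (x ⁻¹)) · u)
    w≈zx⁻¹u A≗SRS = /-injective x {w} {(z · (x ⁻¹)) · u} λ y → begin
      (w / x) y                  ≡⟨ w/x≗SA y ⟩
      S (A y)                    ≡⟨ cong S (A≗SRS y) ⟩
      S (S (R (S y)))            ≡⟨ τ-involutive i j _ ⟩
      R (S y)                    ≡⟨ zx⁻¹u/x≗RS y ⟨
      (((z · (x ⁻¹)) · u) / x) y ∎

  ∈-common-edgeSupp⁺ : {c : Fin n} → R c ≢ c → S c ≢ c → c ∈ edgeSupp x u ∩ edgeSupp x z
  ∈-common-edgeSupp⁺ {c} Rc≢c Sc≢c =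
    x∈p∩q⁺ ( ∈-supp⁺ {π = u · (x ⁻¹)} (Rc≢c ∘ trans (sym (u/x≗R c)))
           , ∈-supp⁺ {π = z · (x ⁻¹)} (Sc≢c ∘ trans (sym (z/x≗S c))))

  ∈-common-edgeSupp⁻ : {c : Fin n} → c ∈ edgeSupp x u ∩ edgeSupp x z → R c ≢ c × S c ≢ c
  ∈-common-edgeSupp⁻ {c} c∈ with x∈p∩q⁻ (edgeSupp x u) (edgeSupp x z) c∈
  ... | c∈u , c∈z = ∈-supp⁻ {π = u · (x ⁻¹)} c∈u ∘ trans (u/x≗R c)
                  , ∈-supp⁻ {π = z · (x ⁻¹)} c∈z ∘ trans (z/x≗S c)

  Empty⇒zx⁻¹u≈ux⁻¹z : Empty (edgeSupp x u ∩ edgeSupp x z) →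
                      ((z · (x ⁻¹)) · u) ≈ ((u · (x ⁻¹)) · z)
  Empty⇒zx⁻¹u≈ux⁻¹z empty = /-injective x {(z · (x ⁻¹)) · u} {(u · (x ⁻¹)) · z} λ y → begin
    (((z · (x ⁻¹)) · u) / x) y   ≡⟨ zx⁻¹u/x≗RS y ⟩
    R (S y)                      ≡⟨ τ-commute (fixed k Rk≢k) (fixed l Rl≢l) y ⟨
    S (R y)                      ≡⟨ ux⁻¹z/x≗SR y ⟨
    (((u · (x ⁻¹)) · z) / x) y   ∎
    where
    fixed : (c : Fin n) → R c ≢ c → S c ≡ c
    fixed c Rc≢c = decidable-stable (S c ≟ c) λ Sc≢c → empty (c , ∈-common-edgeSupp⁺ Rc≢c Sc≢c)
    Rk≢k : R k ≢ k
    Rk≢k Rk≡k = k≢l (trans (sym Rk≡k) (τ-matchˡ k l))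
    Rl≢l : R l ≢ l
    Rl≢l Rl≡l = k≢l (trans (sym (τ-matchʳ k l)) Rl≡l)

  Nonempty⇒zx⁻¹u≉ux⁻¹z : Nonempty (edgeSupp x u ∩ edgeSupp x z) →
                         ¬ ((z · (x ⁻¹)) · u) ≈ ((u · (x ⁻¹)) · z)
  Nonempty⇒zx⁻¹u≉ux⁻¹z (c , c∈) =
    ≉-from-/ x {(z · (x ⁻¹)) · u} {(u · (x ⁻¹)) · z} zx⁻¹u/x≗RS ux⁻¹z/x≗SR λ RS≗SR →
      τ-noncommute {c = c} S≉R Sc≢c Rc≢c (RS≗SR c)
    where
    Rc≢c : R c ≢ c
    Rc≢c = proj₁ (∈-common-edgeSupp⁻ c∈)
    Sc≢c : S c ≢ c
    Sc≢c = proj₂ (∈-common-edgeSupp⁻ c∈)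

corollary2p3 : (n : ℕ) → n ≥ 3 → (u x z : Permutation′ n) → Is2Path u x z →
    (∣ edgeSupp x u ∩ edgeSupp x z ∣ ≡ 0 →
      Is4Cycle x z ((z · (x ⁻¹)) · u) u ×
      (∀ w → Is4Cycle x z w u → w ≈ ((z · (x ⁻¹)) · u)))
    × (∣ edgeSupp x u ∩ edgeSupp x z ∣ ≡ 1 →
      Is4Cycle x z ((z · (x ⁻¹)) · u) u ×
      Is4Cycle x z ((u · (x ⁻¹)) · z) u ×
      ¬ (((z · (x ⁻¹)) · u) ≈ ((u · (x ⁻¹)) · z)) ×
      (∀ w → Is4Cycle x z w u → (w ≈ ((z · (x ⁻¹)) · u)) ⊎ (w ≈ ((u · (x ⁻¹)) · z))))
corollary2p3 n _ u x z (ux , xz , u≉z)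
  with Adj⇒/τ {x = x} {z} xz | Adj⇒/τ {x = x} {u} (Adj-sym {v = u} {x} ux)
... | i , j , i≢j , z/x≗S | k , l , k≢l , u/x≗R = disjoint , overlapping
  where
  W₁ W₂ : Permutation′ n
  W₁ = (z · (x ⁻¹)) · u
  W₂ = (u · (x ⁻¹)) · z
  S≉R : ¬ τ i j ≗ τ k l
  S≉R S≗R = u≉z (/-injective x {u} {z} λ y →
    trans (u/x≗R y) (trans (sym (S≗R y)) (sym (z/x≗S y))))
  open FourCycles {x = x} {z} {u} i≢j k≢l z/x≗S u/x≗R S≉R
  disjoint : ∣ edgeSupp x u ∩ edgeSupp x z ∣ ≡ 0 → Is4Cycle x z W₁ u × (∀ w → Is4Cycle x z w u → w ≈ W₁)
  disjoint ∣I∣≡0 = zx⁻¹u-4cycle , λ w cycle →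
    [ id , (λ w≈W₂ y → trans (w≈W₂ y) (sym (W₁≈W₂ y))) ]′ (fourth-vertex {w} cycle)
    where
    W₁≈W₂ : W₁ ≈ W₂
    W₁≈W₂ = Empty⇒zx⁻¹u≈ux⁻¹z (∣p∣≡0⇒Empty ∣I∣≡0)
  overlapping : ∣ edgeSupp x u ∩ edgeSupp x z ∣ ≡ 1 →
    Is4Cycle x z W₁ u × Is4Cycle x z W₂ u × ¬ W₁ ≈ W₂ × (∀ w → Is4Cycle x z w u → w ≈ W₁ ⊎ w ≈ W₂)
  overlapping ∣I∣≡1 =
    zx⁻¹u-4cycle ,
    Is4Cycle-reverse {x = x} {u} {W₂} {z}
      (FourCycles.zx⁻¹u-4cycle {x = x} {u} {z} k≢l i≢j u/x≗R z/x≗S (λ R≗S → S≉R (sym ∘ R≗S))) ,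
    Nonempty⇒zx⁻¹u≉ux⁻¹z (∣p∣≢0⇒Nonempty (λ ∣I∣≡0 → 1+n≢0 (trans (sym ∣I∣≡1) ∣I∣≡0))) ,
    λ w → fourth-vertex {w}
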